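{- Let $(p,q)\in\mathbb{N}^2$. For $n\in\mathbb{N}$ with $n\ge p+q$, we have $$|S^{p/q}_{n}| \;=\; \sum_{k=1}^{q} (-1)^{k+1}\binom{q}{k}\,|S^{p/q}_{n-k}| \;+\; |S^{p/q}_{n-(p+q)}|.$$
   Context: $\mathbb{N}=\{1,2,3,\dots\}$. For $(p,q)\in\mathbb{N}^2$ and an integer $m\ge 0$, define $$S^{p/q}_m=\{F\subset\mathbb{N} : F \text{ finite nonempty},\ q\min F\ge p|F| \text{ and } \max F=m\},$$ where $|F|$ denotes the cardinality of $F$. In particular $S^{p/q}_0=\emptyset$, since no subset of $\mathbb{N}$ has maximum $0$. -}

module Defs where

open import Data.Nat as ℕ using (ℕ; zero; suc; _*_; _≤_; _≤?_)
open import Data.Fin using (Fin; toℕ; fromℕ)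
open import Data.Fin.Subset using (Subset; _∈_; ∣_∣; inside; outside)
open import Data.Fin.Subset.Properties using (_∈?_)
open import Data.Fin.Properties using (all?)
open import Data.Vec using (_∷_; [])
open import Data.List using (List; []; _∷_; map; _++_; filter; length)
open import Data.Product using (_×_)
open import Relation.Nullary using (Dec)
open import Relation.Nullary.Decidable using (_×-dec_; _→-dec_)
open import Data.Integer as ℤ using (ℤ)

allSubsets : (n : ℕ) → List (Subset n)
allSubsets zero = [] ∷ []
allSubsets (suc n) = map (inside ∷_) (allSubsets n) ++ map (outside ∷_) (allSubsets n)

-- A subset F of Fin (suc m') encodes the finite set {toℕ i + 1 | i ∈ F} ⊆ {1,…,suc m'}.
-- F ∈ S^{p/q}_{suc m'}  iff  max = suc m' (i.e. the top element fromℕ m' ∈ F, which also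
-- makes F nonempty) and q * min F ≥ p * |F|, i.e. q * x ≥ p * |F| for every x ∈ F.
InS : (p q m' : ℕ) → Subset (suc m') → Set
InS p q m' F = (fromℕ m' ∈ F) × (∀ i → i ∈ F → p * ∣ F ∣ ≤ q * (toℕ i ℕ.+ 1))

InS? : (p q m' : ℕ) → (F : Subset (suc m')) → Dec (InS p q m' F)
InS? p q m' F = (fromℕ m' ∈? F) ×-dec all? (λ i → (i ∈? F) →-dec (p * ∣ F ∣ ≤? q * (toℕ i ℕ.+ 1)))

-- |S^{p/q}_m| ; S^{p/q}_0 = ∅ (no subset of ℕ has maximum 0).
cardS : (p q m : ℕ) → ℕ
cardS p q zero = 0
cardS p q (suc m') = length (filter (InS? p q m') (allSubsets (suc m')))

∑[1…_] : ℕ → (ℕ → ℤ) → ℤ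
∑[1… zero ] f = ℤ.0ℤ
∑[1… suc n ] f = ∑[1… n ] f ℤ.+ f (suc n)

module Submission where

open import Defs
open import Data.Nat using (ℕ; suc; _∸_; _≥_; _^_)
open import Data.Nat.Combinatorics using (_C_)
open import Data.Integer using (ℤ; +_; -_; _+_; _*_; -1ℤ)
open import Relation.Binary.PropositionalEquality using (_≡_)

open import Data.Nat as ℕ using (zero; _≤_; _<_; _≤ᵇ_; z≤n; s≤s)
import Data.Nat.Properties as ℕₚ
open import Data.Nat.Combinatorics using (nCk+nC[k+1]≡[n+1]C[k+1]; k>n⇒nCk≡0)
open import Data.Integer as ℤ using (_-_; 0ℤ)
import Data.Integer.Properties as ℤₚ
open import Data.Integer.Solver using (module +-*-Solver)
open import Data.Bool using (Bool; true; false; T; if_then_else_; _∧_)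
open import Data.Bool.Properties using (T-∧)
open import Data.Unit using (tt)
open import Data.Empty using (⊥-elim)
open import Data.Product using (_×_; _,_; proj₁; proj₂)
open import Data.List using (List; []; _∷_; map; _++_; filter; length)
open import Data.Vec using (_∷_; []; here; there)
open import Data.Fin using (Fin; toℕ; fromℕ)
open import Data.Fin.Subset using (Subset; _∈_; ∣_∣; inside; outside)
open import Data.Fin.Subset.Properties using (∣p∣≤n; ∣⁅x⁆∣≡1; p⊆q⇒∣p∣≤∣q∣; x∈⁅y⁆⇒x≡y)
open import Function.Bundles using (_⇔_; mk⇔; Equivalence)
open import Relation.Nullary using (¬_; Dec; does; yes; no; contradiction)
open import Relation.Nullary.Decidable using (does-⇔)
open import Relation.Binary.PropositionalEquality
  using (_≢_; refl; sym; trans; cong; cong₂; subst; subst₂; module ≡-Reasoning)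

open +-*-Solver
open ≡-Reasoning

-- Write a m = |S^{p/q}_m| and ∇ for the backward difference.  The right-hand side minus its last
-- term is a n - ∇^q a n, so the claim is ∇^q a n = a (n - p - q).  Split S^{p/q}_m by cardinality j:
-- a set F with |F| = j belongs to it iff max F = m and every x ∈ F satisfies q x ≥ p j.  This
-- condition is upward closed in x, so the number T_j(m) of such sets is a binomial coefficient in
-- the number of admissible points below m, and Pascal's rule gives ∇ T_{j+1}(m) = T_j(m - 1).
-- For j ≤ q, ∇^{j-1} T_j is the constant 1 on [n - q, n], so ∇^q T_j(n) = 0.  For j = q + J,
-- ∇^q T_{q+J}(n) = T_{q+J}(n - q) = T_J(n - p - q), because q x ≥ p (q + J) iff q (x - p) ≥ p J:
-- the admissible points for q + J are those for J moved up by p.  Summing over J gives a (n - p - q).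

m∸n∸1≡m∸[1+n] : ∀ m n → m ∸ n ∸ 1 ≡ m ∸ suc n
m∸n∸1≡m∸[1+n] m n = trans (ℕₚ.∸-+-assoc m n 1) (cong (m ∸_) (ℕₚ.+-comm n 1))

m∸n∸1≡m∸1∸n : ∀ m n → m ∸ n ∸ 1 ≡ m ∸ 1 ∸ n
m∸n∸1≡m∸1∸n m n = trans (m∸n∸1≡m∸[1+n] m n) (sym (ℕₚ.∸-+-assoc m 1 n))

-- Sums ∑[1… n ]

∑-cong : ∀ n {f g : ℕ → ℤ} → (∀ {k} → k < n → f (suc k) ≡ g (suc k)) → ∑[1… n ] f ≡ ∑[1… n ] g
∑-cong zero    f≡g = refl
∑-cong (suc n) f≡g = cong₂ _+_ (∑-cong n (λ k<n → f≡g (ℕₚ.m<n⇒m<1+n k<n))) (f≡g (ℕₚ.n<1+n n))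

∑-zero : ∀ n {f : ℕ → ℤ} → (∀ {k} → k < n → f (suc k) ≡ 0ℤ) → ∑[1… n ] f ≡ 0ℤ
∑-zero zero    f≡0 = refl
∑-zero (suc n) f≡0 = cong₂ _+_ (∑-zero n (λ k<n → f≡0 (ℕₚ.m<n⇒m<1+n k<n))) (f≡0 (ℕₚ.n<1+n n))

∑-distrib-+ : ∀ n (f g : ℕ → ℤ) → ∑[1… n ] (λ k → f k + g k) ≡ ∑[1… n ] f + ∑[1… n ] g
∑-distrib-+ zero    f g = refl
∑-distrib-+ (suc n) f g = begin
  ∑[1… n ] (λ k → f k + g k) + (f (suc n) + g (suc n))
    ≡⟨ cong (_+ (f (suc n) + g (suc n))) (∑-distrib-+ n f g) ⟩
  ∑[1… n ] f + ∑[1… n ] g + (f (suc n) + g (suc n))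
    ≡⟨ solve 4 (λ a b c d → (a :+ b) :+ (c :+ d) := (a :+ c) :+ (b :+ d)) refl
         (∑[1… n ] f) (∑[1… n ] g) (f (suc n)) (g (suc n)) ⟩
  ∑[1… n ] f + f (suc n) + (∑[1… n ] g + g (suc n)) ∎

∑-neg : ∀ n (f : ℕ → ℤ) → ∑[1… n ] (λ k → - f k) ≡ - ∑[1… n ] f
∑-neg zero    f = refl
∑-neg (suc n) f = trans (cong (_+ - f (suc n)) (∑-neg n f)) (sym (ℤₚ.neg-distrib-+ (∑[1… n ] f) (f (suc n))))

∑-distrib-minus : ∀ n (f g : ℕ → ℤ) → ∑[1… n ] (λ k → f k - g k) ≡ ∑[1… n ] f - ∑[1… n ] g
∑-distrib-minus n f g = trans (∑-distrib-+ n f (λ k → - g k)) (cong (λ x → ∑[1… n ] f + x) (∑-neg n g))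

∑-unfoldˡ : ∀ n (f : ℕ → ℤ) → ∑[1… suc n ] f ≡ f 1 + ∑[1… n ] (λ k → f (suc k))
∑-unfoldˡ zero    f = ℤₚ.+-comm 0ℤ (f 1)
∑-unfoldˡ (suc n) f = trans (cong (_+ f (suc (suc n))) (∑-unfoldˡ n f)) (ℤₚ.+-assoc (f 1) _ _)

∑-split : ∀ m n (f : ℕ → ℤ) → ∑[1… m ℕ.+ n ] f ≡ ∑[1… m ] f + ∑[1… n ] (λ k → f (m ℕ.+ k))
∑-split m zero    f = trans (cong (λ l → ∑[1… l ] f) (ℕₚ.+-identityʳ m)) (sym (ℤₚ.+-identityʳ _))
∑-split m (suc n) f = begin
  ∑[1… m ℕ.+ suc n ] f                                 ≡⟨ cong (λ l → ∑[1… l ] f) (ℕₚ.+-suc m n) ⟩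
  ∑[1… m ℕ.+ n ] f + f (suc (m ℕ.+ n))                 ≡⟨ cong₂ _+_ (∑-split m n f) (cong f (sym (ℕₚ.+-suc m n))) ⟩
  ∑[1… m ] f + ∑[1… n ] (λ k → f (m ℕ.+ k)) + f (m ℕ.+ suc n) ≡⟨ ℤₚ.+-assoc (∑[1… m ] f) _ _ ⟩
  ∑[1… m ] f + ∑[1… suc n ] (λ k → f (m ℕ.+ k))        ∎

∑-single : ∀ {M c} (f : ℕ → ℤ) → 1 ≤ c → c ≤ M → (∀ j → j ≢ c → f j ≡ 0ℤ) → ∑[1… M ] f ≡ f c
∑-single {zero}  f (s≤s _) ()
∑-single {suc M} {c} f 1≤c c≤1+M f≡0 with c ℕ.≟ suc M
... | yes refl = begin
  ∑[1… M ] f + f (suc M) ≡⟨ cong (_+ f (suc M)) (∑-zero M (λ k<M → f≡0 _ (ℕₚ.<⇒≢ (s≤s k<M)))) ⟩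
  0ℤ + f (suc M)         ≡⟨ ℤₚ.+-identityˡ _ ⟩
  f (suc M)              ∎
... | no c≢1+M = begin
  ∑[1… M ] f + f (suc M) ≡⟨ cong₂ _+_ (∑-single f 1≤c (ℕ.≤-pred (ℕₚ.≤∧≢⇒< c≤1+M c≢1+M)) f≡0)
                                     (f≡0 _ (λ e → c≢1+M (sym e))) ⟩
  f c + 0ℤ               ≡⟨ ℤₚ.+-identityʳ (f c) ⟩
  f c                    ∎

-- Backward differences

-- Truncated subtraction makes ∇ g 0 = 0.
∇ : (ℕ → ℤ) → ℕ → ℤ
∇ g m = g m - g (m ∸ 1)

∇^ : ℕ → (ℕ → ℤ) → ℕ → ℤ
∇^ zero    g = g
∇^ (suc t) g = ∇^ t (∇ g)

sign : ℕ → ℤ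
sign k = -1ℤ ℤ.^ (k ℕ.+ 1)

binomialTail : ℕ → (ℕ → ℤ) → ℕ → ℤ
binomialTail q g n = ∑[1… q ] (λ k → sign k * + (q C k) * g (n ∸ k))

binomialTail-∇ : ∀ q g n → binomialTail q (∇ g) n ≡ binomialTail q g n - binomialTail q g (n ∸ 1)
binomialTail-∇ q g n = begin
  ∑[1… q ] (λ k → c k * (g (n ∸ k) - g (n ∸ k ∸ 1)))
    ≡⟨ ∑-cong q (λ {k} _ → distrib (suc k)) ⟩
  ∑[1… q ] (λ k → c k * g (n ∸ k) - c k * g (n ∸ 1 ∸ k))
    ≡⟨ ∑-distrib-minus q _ _ ⟩
  binomialTail q g n - binomialTail q g (n ∸ 1) ∎
  where
  c : ℕ → ℤ
  c k = sign k * + (q C k)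
  distrib : ∀ k → c k * (g (n ∸ k) - g (n ∸ k ∸ 1)) ≡ c k * g (n ∸ k) - c k * g (n ∸ 1 ∸ k)
  distrib k rewrite m∸n∸1≡m∸1∸n n k =
    solve 3 (λ c x y → c :* (x :- y) := c :* x :- c :* y) refl (c k) (g (n ∸ k)) (g (n ∸ 1 ∸ k))

binomialTail-suc : ∀ q g n → binomialTail (suc q) g n ≡ g (n ∸ 1) - binomialTail q g (n ∸ 1) + binomialTail q g n
binomialTail-suc q g n = begin
  binomialTail (suc q) g n                  ≡⟨ ∑-cong (suc q) (λ {k} _ → pascal k) ⟩
  ∑[1… suc q ] (λ k → lower k + upper k)    ≡⟨ ∑-distrib-+ (suc q) lower upper ⟩
  ∑[1… suc q ] lower + ∑[1… suc q ] upper   ≡⟨ cong₂ _+_ ∑lower ∑upper ⟩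
  g (n ∸ 1) - binomialTail q g (n ∸ 1) + binomialTail q g n ∎
  where
  lower upper : ℕ → ℤ
  lower k = sign k * + (q C (k ∸ 1)) * g (n ∸ k)
  upper k = sign k * + (q C k) * g (n ∸ k)

  pascal : ∀ k → sign (suc k) * + (suc q C suc k) * g (n ∸ suc k) ≡ lower (suc k) + upper (suc k)
  pascal k = begin
    sign (suc k) * + (suc q C suc k) * g (n ∸ suc k)
      ≡⟨ cong (λ c → sign (suc k) * + c * g (n ∸ suc k)) (sym (nCk+nC[k+1]≡[n+1]C[k+1] q k)) ⟩
    sign (suc k) * (+ (q C k) + + (q C suc k)) * g (n ∸ suc k)
      ≡⟨ solve 4 (λ s a b x → s :* (a :+ b) :* x := s :* a :* x :+ s :* b :* x) refl
           (sign (suc k)) (+ (q C k)) (+ (q C suc k)) (g (n ∸ suc k)) ⟩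
    lower (suc k) + upper (suc k) ∎

  lower-suc : ∀ k → lower (suc k) ≡ - (sign k * + (q C k) * g (n ∸ 1 ∸ k))
  lower-suc k rewrite ℕₚ.∸-+-assoc n 1 k =
    solve 3 (λ s c x → con -1ℤ :* s :* c :* x := :- (s :* c :* x)) refl (sign k) (+ (q C k)) (g (n ∸ suc k))

  ∑lower : ∑[1… suc q ] lower ≡ g (n ∸ 1) - binomialTail q g (n ∸ 1)
  ∑lower = begin
    ∑[1… suc q ] lower                         ≡⟨ ∑-unfoldˡ q lower ⟩
    lower 1 + ∑[1… q ] (λ k → lower (suc k))   ≡⟨ cong₂ _+_ (ℤₚ.*-identityˡ (g (n ∸ 1)))
                                                   (trans (∑-cong q (λ {k} _ → lower-suc (suc k))) (∑-neg q _)) ⟩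
    g (n ∸ 1) - binomialTail q g (n ∸ 1)       ∎

  ∑upper : ∑[1… suc q ] upper ≡ binomialTail q g n
  ∑upper = trans (cong (λ x → ∑[1… q ] upper + x) upper-last) (ℤₚ.+-identityʳ _)
    where
    upper-last : upper (suc q) ≡ 0ℤ
    upper-last rewrite k>n⇒nCk≡0 (ℕₚ.n<1+n q) =
      solve 2 (λ s x → s :* con 0ℤ :* x := con 0ℤ) refl (sign (suc q)) (g (n ∸ suc q))

∇^-binomial : ∀ q g n → ∇^ q g n ≡ g n - binomialTail q g n
∇^-binomial zero    g n = sym (ℤₚ.+-identityʳ (g n))
∇^-binomial (suc q) g n = begin
  ∇^ q (∇ g) n                                            ≡⟨ ∇^-binomial q (∇ g) n ⟩
  ∇ g n - binomialTail q (∇ g) n                          ≡⟨ cong (λ x → ∇ g n - x) (binomialTail-∇ q g n) ⟩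
  g n - g (n ∸ 1) - (binomialTail q g n - binomialTail q g (n ∸ 1))
    ≡⟨ solve 4 (λ x y b b′ → x :- y :- (b :- b′) := x :- (y :- b′ :+ b)) refl
         (g n) (g (n ∸ 1)) (binomialTail q g n) (binomialTail q g (n ∸ 1)) ⟩
  g n - (g (n ∸ 1) - binomialTail q g (n ∸ 1) + binomialTail q g n)
                                                          ≡⟨ cong (λ x → g n - x) (sym (binomialTail-suc q g n)) ⟩
  g n - binomialTail (suc q) g n                          ∎

∇^-local : ∀ t {f g : ℕ → ℤ} n → (∀ {i} → i ≤ t → f (n ∸ i) ≡ g (n ∸ i)) → ∇^ t f n ≡ ∇^ t g n
∇^-local zero            n f≡g = f≡g z≤n
∇^-local (suc t) {f} {g} n f≡g = ∇^-local t n λ {i} i≤t →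
  cong₂ _-_ (f≡g (ℕₚ.m≤n⇒m≤1+n i≤t))
            (subst (λ m → f m ≡ g m) (sym (m∸n∸1≡m∸[1+n] n i)) (f≡g (s≤s i≤t)))

∇^-cong : ∀ t {f g : ℕ → ℤ} n → (∀ m → f m ≡ g m) → ∇^ t f n ≡ ∇^ t g n
∇^-cong t n f≡g = ∇^-local t n (λ _ → f≡g _)

∇^-+ : ∀ s t (f : ℕ → ℤ) n → ∇^ (s ℕ.+ t) f n ≡ ∇^ t (∇^ s f) n
∇^-+ zero    t f n = refl
∇^-+ (suc s) t f n = ∇^-+ s t (∇ f) n

∇^-∘pred : ∀ t (f : ℕ → ℤ) n → ∇^ t (λ m → f (m ∸ 1)) n ≡ ∇^ t f (n ∸ 1)
∇^-∘pred zero    f n = refl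
∇^-∘pred (suc t) f n = ∇^-∘pred t (∇ f) n

∇^-zero : ∀ t n → ∇^ t (λ _ → 0ℤ) n ≡ 0ℤ
∇^-zero zero    n = refl
∇^-zero (suc t) n = ∇^-zero t n

∇^-const : ∀ t c n → ∇^ (suc t) (λ _ → c) n ≡ 0ℤ
∇^-const t c n = trans (∇^-cong t n (λ _ → ℤₚ.+-inverseʳ c)) (∇^-zero t n)

∇^-∑ : ∀ t N (h : ℕ → ℕ → ℤ) n → ∇^ t (λ m → ∑[1… N ] (λ j → h j m)) n ≡ ∑[1… N ] (λ j → ∇^ t (h j) n)
∇^-∑ zero    N h n = refl
∇^-∑ (suc t) N h n = trans (∇^-cong t n (λ m → sym (∑-distrib-minus N (λ j → h j m) (λ j → h j (m ∸ 1)))))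
                           (∇^-∑ t N (λ j → ∇ (h j)) n)

-- Counting with indicators

indicator : Bool → ℕ
indicator true  = 1
indicator false = 0

indicator-true : ∀ {b} → T b → indicator b ≡ 1
indicator-true {true} _ = refl

indicator-false : ∀ {b} → ¬ T b → indicator b ≡ 0
indicator-false {false} _  = refl
indicator-false {true}  ¬b = ⊥-elim (¬b tt)

∑-indicator-unique : ∀ {M J} (c : ℕ → Bool) → 1 ≤ J → J ≤ M → (∀ {j} → T (c j) → j ≡ J) →
                     ∑[1… M ] (λ j → + indicator (c j)) ≡ + indicator (c J)
∑-indicator-unique c 1≤J J≤M unique =
  ∑-single _ 1≤J J≤M (λ j j≢J → cong +_ (indicator-false (λ cj → j≢J (unique cj))))

count : {A : Set} → (A → Bool) → List A → ℕ
count b []       = 0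
count b (x ∷ xs) = indicator (b x) ℕ.+ count b xs

length-filter≡count : {A : Set} {P : A → Set} (P? : ∀ x → Dec (P x)) (xs : List A) →
                      length (filter P? xs) ≡ count (λ x → does (P? x)) xs
length-filter≡count P? []       = refl
length-filter≡count P? (x ∷ xs) with does (P? x)
... | true  = cong suc (length-filter≡count P? xs)
... | false = length-filter≡count P? xs

count-++ : {A : Set} (b : A → Bool) (xs ys : List A) → count b (xs ++ ys) ≡ count b xs ℕ.+ count b ys
count-++ b []       ys = refl
count-++ b (x ∷ xs) ys = trans (cong (indicator (b x) ℕ.+_) (count-++ b xs ys)) (sym (ℕₚ.+-assoc (indicator (b x)) _ _))

count-map : {A B : Set} (b : B → Bool) (f : A → B) (xs : List A) → count b (map f xs) ≡ count (λ x → b (f x)) xs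
count-map b f []       = refl
count-map b f (x ∷ xs) = cong (indicator (b (f x)) ℕ.+_) (count-map b f xs)

count-∧ : {A : Set} (c : Bool) (b : A → Bool) (xs : List A) → count (λ x → c ∧ b x) xs ≡ (if c then count b xs else 0)
count-∧ true  b xs       = refl
count-∧ false b []       = refl
count-∧ false b (x ∷ xs) = count-∧ false b xs

count-∑ : {A : Set} (b : A → Bool) (c : ℕ → A → Bool) (M : ℕ) (xs : List A) →
          (∀ x → + indicator (b x) ≡ ∑[1… M ] (λ j → + indicator (c j x))) →
          + count b xs ≡ ∑[1… M ] (λ j → + count (c j) xs)
count-∑ b c M []       _ = sym (∑-zero M (λ _ → refl))
count-∑ b c M (x ∷ xs) b≡∑c = begin
  + (indicator (b x) ℕ.+ count b xs)
    ≡⟨ ℤₚ.pos-+ (indicator (b x)) _ ⟩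
  + indicator (b x) + + count b xs
    ≡⟨ cong₂ _+_ (b≡∑c x) (count-∑ b c M xs b≡∑c) ⟩
  ∑[1… M ] (λ j → + indicator (c j x)) + ∑[1… M ] (λ j → + count (c j) xs)
    ≡⟨ sym (∑-distrib-+ M _ _) ⟩
  ∑[1… M ] (λ j → + indicator (c j x) + + count (c j) xs)
    ≡⟨ ∑-cong M (λ {k} _ → sym (ℤₚ.pos-+ (indicator (c (suc k) x)) _)) ⟩
  ∑[1… M ] (λ j → + count (c j) (x ∷ xs)) ∎

count-allSubsets : ∀ n (b : Subset (suc n) → Bool) → count b (allSubsets (suc n)) ≡
                   count (λ F → b (inside ∷ F)) (allSubsets n) ℕ.+ count (λ F → b (outside ∷ F)) (allSubsets n)
count-allSubsets n b = trans (count-++ b (map (inside ∷_) (allSubsets n)) (map (outside ∷_) (allSubsets n)))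
                             (cong₂ ℕ._+_ (count-map b (inside ∷_) (allSubsets n)) (count-map b (outside ∷_) (allSubsets n)))

-- Sets with prescribed maximum and cardinality

UpwardClosed : (ℕ → Bool) → Set
UpwardClosed Q = ∀ {i} → T (Q i) → T (Q (suc i))

trueCount : (ℕ → Bool) → ℕ → ℕ
trueCount Q zero    = 0
trueCount Q (suc m) = trueCount Q m ℕ.+ indicator (Q m)

-- topSets Q j m counts the j-element sets F ⊆ {0, …, m - 1} with max F = m - 1 on which Q holds.
topSets : (ℕ → Bool) → ℕ → ℕ → ℕ
topSets Q j       zero    = 0
topSets Q zero    (suc m) = 0
topSets Q (suc j) (suc m) = if Q m then trueCount Q m C j else 0

trueCount-below : ∀ {Q} s → (∀ {i} → i < s → ¬ T (Q i)) → trueCount Q s ≡ 0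
trueCount-below zero    _     = refl
trueCount-below (suc s) ¬Q<s = cong₂ ℕ._+_ (trueCount-below s (λ i<s → ¬Q<s (ℕₚ.m<n⇒m<1+n i<s)))
                                           (indicator-false (¬Q<s (ℕₚ.n<1+n s)))

trueCount-≡0 : ∀ {Q} → UpwardClosed Q → ∀ {m} → ¬ T (Q m) → trueCount Q m ≡ 0
trueCount-≡0     up {zero}  _        = refl
trueCount-≡0 {Q} up {suc m} ¬Q[1+m] = cong₂ ℕ._+_ (trueCount-≡0 {Q} up ¬Qm) (indicator-false ¬Qm)
  where ¬Qm = λ Qm → ¬Q[1+m] (up Qm)

trueCount-unfoldˡ : ∀ Q m → trueCount Q (suc m) ≡ indicator (Q 0) ℕ.+ trueCount (λ i → Q (suc i)) m
trueCount-unfoldˡ Q zero    = ℕₚ.+-comm 0 (indicator (Q 0))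
trueCount-unfoldˡ Q (suc m) = trans (cong (ℕ._+ indicator (Q (suc m))) (trueCount-unfoldˡ Q m))
                                    (ℕₚ.+-assoc (indicator (Q 0)) _ _)

topSets-false : ∀ {Q} j {m} → ¬ T (Q m) → topSets Q j (suc m) ≡ 0
topSets-false {Q} zero    _       = refl
topSets-false {Q} (suc j) {m} ¬Qm with Q m | ¬Qm
... | true  | ¬t = ⊥-elim (¬t tt)
... | false | _  = refl

topSets-one : ∀ {Q m} → T (Q m) → topSets Q 1 (suc m) ≡ 1
topSets-one {Q} {m} Qm with Q m
... | true = refl

topSets-pascal : ∀ {Q} → UpwardClosed Q → ∀ j m →
                 topSets Q (2 ℕ.+ j) (suc m) ≡ topSets Q (2 ℕ.+ j) m ℕ.+ topSets Q (suc j) m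
topSets-pascal {Q} up j zero with Q 0
... | true  = refl
... | false = refl
topSets-pascal {Q} up j (suc m) with Q m | Q (suc m) | up {m} | trueCount-≡0 {Q} up {m}
... | true  | true  | _      | _       = pascal (trueCount Q m)
  where
  pascal : ∀ w → (w ℕ.+ 1) C suc j ≡ w C suc j ℕ.+ w C j
  pascal w = trans (cong (_C suc j) (ℕₚ.+-comm w 1))
                   (trans (sym (nCk+nC[k+1]≡[n+1]C[k+1] w j)) (ℕₚ.+-comm (w C j) _))
... | true  | false | Qm⇒Q[1+m] | _     = ⊥-elim (Qm⇒Q[1+m] tt)
... | false | true  | _      | count≡0 rewrite count≡0 (λ ()) = refl
... | false | false | _      | _       = refl

-- Splitting on whether 0 belongs to the set.
topSets-unfoldˡ : ∀ Q j m → topSets Q (suc j) (2 ℕ.+ m) ≡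
                  (if Q 0 then topSets (λ i → Q (suc i)) j (suc m) else 0) ℕ.+ topSets (λ i → Q (suc i)) (suc j) (suc m)
topSets-unfoldˡ Q zero    m with Q 0
... | true  = refl
... | false = refl
topSets-unfoldˡ Q (suc j) m rewrite trueCount-unfoldˡ Q m with Q 0 | Q (suc m)
... | true  | true  = sym (nCk+nC[k+1]≡[n+1]C[k+1] (trueCount (λ i → Q (suc i)) m) j)
... | false | true  = refl
... | true  | false = refl
... | false | false = refl

∇-topSets : ∀ {Q} → UpwardClosed Q → ∀ j → 1 ≤ j → ∀ m →
            ∇ (λ x → + topSets Q (suc j) x) m ≡ + topSets Q j (m ∸ 1)
∇-topSets     up (suc j) _ zero    = refl
∇-topSets {Q} up (suc j) _ (suc m) = begin
  + topSets Q (2 ℕ.+ j) (suc m) - + topSets Q (2 ℕ.+ j) m ≡⟨ cong (λ x → + x - + a) (topSets-pascal up j m) ⟩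
  + (a ℕ.+ b) - + a                                      ≡⟨ cong (_- + a) (ℤₚ.pos-+ a b) ⟩
  + a + + b - + a                                        ≡⟨ solve 2 (λ x y → x :+ y :- x := y) refl (+ a) (+ b) ⟩
  + b                                                    ∎
  where
  a = topSets Q (2 ℕ.+ j) m
  b = topSets Q (suc j) m

∇^-topSets : ∀ {Q} → UpwardClosed Q → ∀ s J → 1 ≤ J → ∀ n →
             ∇^ s (λ m → + topSets Q (s ℕ.+ J) m) n ≡ + topSets Q J (n ∸ s)
∇^-topSets     up zero    J 1≤J n = refl
∇^-topSets {Q} up (suc s) J 1≤J n = begin
  ∇^ s (∇ (λ m → + topSets Q (suc s ℕ.+ J) m)) n
    ≡⟨ ∇^-cong s n (∇-topSets up (s ℕ.+ J) (ℕₚ.≤-trans 1≤J (ℕₚ.m≤n+m J s))) ⟩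
  ∇^ s (λ m → + topSets Q (s ℕ.+ J) (m ∸ 1)) n  ≡⟨ ∇^-∘pred s _ n ⟩
  ∇^ s (λ m → + topSets Q (s ℕ.+ J) m) (n ∸ 1)  ≡⟨ ∇^-topSets up s J 1≤J (n ∸ 1) ⟩
  + topSets Q J (n ∸ 1 ∸ s)                     ≡⟨ cong (λ x → + topSets Q J x) (ℕₚ.∸-+-assoc n 1 s) ⟩
  + topSets Q J (n ∸ suc s)                     ∎

module _ {Q R : ℕ → Bool} {s : ℕ} (¬Q<s : ∀ {i} → i < s → ¬ T (Q i)) (Q≡R : ∀ i → Q (s ℕ.+ i) ≡ R i) where

  trueCount-shift : ∀ m → trueCount Q (s ℕ.+ m) ≡ trueCount R m
  trueCount-shift zero    = trans (cong (trueCount Q) (ℕₚ.+-identityʳ s)) (trueCount-below s ¬Q<s)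
  trueCount-shift (suc m) rewrite ℕₚ.+-suc s m = cong₂ ℕ._+_ (trueCount-shift m) (cong indicator (Q≡R m))

  topSets-shift : ∀ j m → topSets Q j (s ℕ.+ m) ≡ topSets R j m
  topSets-shift j zero rewrite ℕₚ.+-identityʳ s = below s ¬Q<s
    where
    below : ∀ t → (∀ {i} → i < t → ¬ T (Q i)) → topSets Q j t ≡ 0
    below zero    _    = refl
    below (suc t) ¬Q<t = topSets-false j (¬Q<t (ℕₚ.n<1+n t))
  topSets-shift zero    (suc m) rewrite ℕₚ.+-suc s m = refl
  topSets-shift (suc j) (suc m) rewrite ℕₚ.+-suc s m | Q≡R m | trueCount-shift m = refl

isTopSet : (m j : ℕ) → (ℕ → Bool) → Subset (suc m) → Bool
isTopSet zero    1       Q (inside  ∷ []) = Q 0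
isTopSet zero    _       Q _              = false
isTopSet (suc m) j       Q (outside ∷ F)  = isTopSet m j (λ i → Q (suc i)) F
isTopSet (suc m) zero    Q (inside  ∷ F)  = false
isTopSet (suc m) (suc j) Q (inside  ∷ F)  = Q 0 ∧ isTopSet m j (λ i → Q (suc i)) F

count-isTopSet : ∀ m j Q → count (isTopSet m j Q) (allSubsets (suc m)) ≡ topSets Q j (suc m)
count-isTopSet zero    zero          Q = refl
count-isTopSet zero    (suc zero)    Q with Q 0
... | true  = refl
... | false = refl
count-isTopSet zero    (suc (suc j)) Q with Q 0
... | true  = refl
... | false = refl
count-isTopSet (suc m) zero          Q = begin
  count (isTopSet (suc m) 0 Q) (allSubsets (2 ℕ.+ m))
    ≡⟨ count-allSubsets (suc m) _ ⟩
  count (λ F → false) (allSubsets (suc m)) ℕ.+ count (isTopSet m 0 Q′) (allSubsets (suc m))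
    ≡⟨ cong₂ ℕ._+_ (count-∧ false (λ _ → false) (allSubsets (suc m))) (count-isTopSet m 0 Q′) ⟩
  0 ∎
  where Q′ = λ i → Q (suc i)
count-isTopSet (suc m) (suc j)       Q = begin
  count (isTopSet (suc m) (suc j) Q) (allSubsets (2 ℕ.+ m))
    ≡⟨ count-allSubsets (suc m) _ ⟩
  count (λ F → Q 0 ∧ isTopSet m j Q′ F) (allSubsets (suc m)) ℕ.+ count (isTopSet m (suc j) Q′) (allSubsets (suc m))
    ≡⟨ cong₂ ℕ._+_ (count-∧ (Q 0) (isTopSet m j Q′) (allSubsets (suc m))) (count-isTopSet m (suc j) Q′) ⟩
  (if Q 0 then count (isTopSet m j Q′) (allSubsets (suc m)) else 0) ℕ.+ topSets Q′ (suc j) (suc m)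
    ≡⟨ cong (λ c → (if Q 0 then c else 0) ℕ.+ topSets Q′ (suc j) (suc m)) (count-isTopSet m j Q′) ⟩
  (if Q 0 then topSets Q′ j (suc m) else 0) ℕ.+ topSets Q′ (suc j) (suc m)
    ≡⟨ sym (topSets-unfoldˡ Q j m) ⟩
  topSets Q (suc j) (2 ℕ.+ m) ∎
  where Q′ = λ i → Q (suc i)

AllSatisfy : ∀ {n} → (ℕ → Bool) → Subset n → Set
AllSatisfy Q F = ∀ {i} → i ∈ F → T (Q (toℕ i))

TopSet : (m j : ℕ) → (ℕ → Bool) → Subset (suc m) → Set
TopSet m j Q F = fromℕ m ∈ F × ∣ F ∣ ≡ j × AllSatisfy Q F

isTopSet-sound : ∀ m j Q F → T (isTopSet m j Q F) → TopSet m j Q F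
isTopSet-sound zero    (suc zero) Q (inside  ∷ []) Q0 = here , refl , λ { here → Q0 }
isTopSet-sound (suc m) (suc j)    Q (inside  ∷ F)  t
  with Q0 , t′ ← Equivalence.to T-∧ t
  with top , refl , all ← isTopSet-sound m j (λ i → Q (suc i)) F t′
  = there top , refl , λ { here → Q0 ; (there i∈F) → all i∈F }
isTopSet-sound (suc m) j          Q (outside ∷ F)  t
  with top , size , all ← isTopSet-sound m j (λ i → Q (suc i)) F t
  = there top , size , λ { (there i∈F) → all i∈F }

isTopSet-complete : ∀ m j Q F → TopSet m j Q F → T (isTopSet m j Q F)
isTopSet-complete zero    _ Q (inside  ∷ []) (here , refl , all) = all here
isTopSet-complete (suc m) _ Q (inside  ∷ F)  (there top , refl , all) =
  Equivalence.from T-∧ (all here , isTopSet-complete m _ (λ i → Q (suc i)) F (top , refl , λ i∈F → all (there i∈F)))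
isTopSet-complete (suc m) j Q (outside ∷ F)  (there top , size , all) =
  isTopSet-complete m j (λ i → Q (suc i)) F (top , size , λ i∈F → all (there i∈F))

x∈p⇒1≤∣p∣ : ∀ {n} {x : Fin n} {p : Subset n} → x ∈ p → 1 ≤ ∣ p ∣
x∈p⇒1≤∣p∣ {x = x} {p} x∈p =
  subst (_≤ ∣ p ∣) (∣⁅x⁆∣≡1 x) (p⊆q⇒∣p∣≤∣q∣ (λ y∈⁅x⁆ → subst (_∈ p) (sym (x∈⁅y⁆⇒x≡y x y∈⁅x⁆)) x∈p))

-- The sets S^{p/q}

-- admissible p q j i says that the element i + 1 may belong to a j-element set of S^{p/q}.
admissible : (p q j : ℕ) → ℕ → Bool
admissible p q j i = p ℕ.* j ≤ᵇ q ℕ.* (i ℕ.+ 1)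

InS⇔TopSet : ∀ p q m F → InS p q m F ⇔ TopSet m ∣ F ∣ (admissible p q ∣ F ∣) F
InS⇔TopSet p q m F = mk⇔ (λ (top , bound) → top , refl , λ {i} i∈F → ℕₚ.≤⇒≤ᵇ (bound i i∈F))
                         (λ (top , _ , adm) → top , λ i i∈F → ℕₚ.≤ᵇ⇒≤ _ _ (adm i∈F))

indicator-InS : ∀ p q m {M} F → suc m ≤ M → (inS? : Dec (InS p q m F)) →
                + indicator (does inS?) ≡ ∑[1… M ] (λ j → + indicator (isTopSet m j (admissible p q j) F))
indicator-InS p q m {M} F 1+m≤M (yes inS) = sym (begin
  ∑[1… M ] (λ j → + indicator (c j))
    ≡⟨ ∑-indicator-unique c (x∈p⇒1≤∣p∣ (proj₁ inS)) (ℕₚ.≤-trans (∣p∣≤n F) 1+m≤M) card ⟩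
  + indicator (c ∣ F ∣)
    ≡⟨ cong +_ (indicator-true (isTopSet-complete m _ _ F (Equivalence.to (InS⇔TopSet p q m F) inS))) ⟩
  + 1 ∎)
  where
  c : ℕ → Bool
  c j = isTopSet m j (admissible p q j) F
  card : ∀ {j} → T (c j) → j ≡ ∣ F ∣
  card t = sym (proj₁ (proj₂ (isTopSet-sound m _ _ F t)))
indicator-InS p q m {M} F 1+m≤M (no ¬inS) =
  sym (∑-zero M (λ _ → cong +_ (indicator-false (λ t → ¬inS (topSet⇒InS t)))))
  where
  topSet⇒InS : ∀ {j} → T (isTopSet m j (admissible p q j) F) → InS p q m F
  topSet⇒InS t with top , refl , adm ← isTopSet-sound m _ _ F t =
    Equivalence.from (InS⇔TopSet p q m F) (top , refl , adm)

cardS≡∑topSets : ∀ p q {m M} → m ≤ M → + cardS p q m ≡ ∑[1… M ] (λ j → + topSets (admissible p q j) j m)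
cardS≡∑topSets p q {zero}  {M} _     = sym (∑-zero M (λ _ → refl))
cardS≡∑topSets p q {suc m} {M} 1+m≤M = begin
  + length (filter (InS? p q m) (allSubsets (suc m)))
    ≡⟨ cong +_ (length-filter≡count (InS? p q m) (allSubsets (suc m))) ⟩
  + count (λ F → does (InS? p q m F)) (allSubsets (suc m))
    ≡⟨ count-∑ _ (λ j → isTopSet m j (admissible p q j)) M (allSubsets (suc m))
               (λ F → indicator-InS p q m F 1+m≤M (InS? p q m F)) ⟩
  ∑[1… M ] (λ j → + count (isTopSet m j (admissible p q j)) (allSubsets (suc m)))
    ≡⟨ ∑-cong M (λ {k} _ → cong +_ (count-isTopSet m (suc k) _)) ⟩
  ∑[1… M ] (λ j → + topSets (admissible p q j) j (suc m)) ∎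

admissible-upward : ∀ p q j → UpwardClosed (admissible p q j)
admissible-upward p q j {i} adm =
  ℕₚ.≤⇒≤ᵇ (ℕₚ.≤-trans (ℕₚ.≤ᵇ⇒≤ (p ℕ.* j) _ adm) (ℕₚ.*-monoʳ-≤ q (ℕₚ.n≤1+n (i ℕ.+ 1))))

admissible-small : ∀ p q {j i} → j ≤ q → p ≤ suc i → T (admissible p q j i)
admissible-small p q {j} {i} j≤q p≤1+i = ℕₚ.≤⇒≤ᵇ
  (ℕₚ.≤-trans (ℕₚ.*-monoʳ-≤ p j≤q)
  (ℕₚ.≤-trans (ℕₚ.≤-reflexive (ℕₚ.*-comm p q))
              (ℕₚ.*-monoʳ-≤ q (subst (p ≤_) (ℕₚ.+-comm 1 i) p≤1+i))))

admissible-below : ∀ p q {J i} → 1 ≤ p → 1 ≤ J → i < p → ¬ T (admissible p q (q ℕ.+ J) i)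
admissible-below p q {J} {i} 1≤p 1≤J i<p adm = ℕₚ.<⇒≱ pq<p[q+J]
  (ℕₚ.≤-trans (ℕₚ.≤ᵇ⇒≤ _ _ adm)
  (ℕₚ.≤-trans (ℕₚ.*-monoʳ-≤ q (subst (_≤ p) (ℕₚ.+-comm 1 i) i<p))
              (ℕₚ.≤-reflexive (ℕₚ.*-comm q p))))
  where
  pq<p[q+J] : p ℕ.* q < p ℕ.* (q ℕ.+ J)
  pq<p[q+J] = subst (p ℕ.* q <_) (sym (ℕₚ.*-distribˡ-+ p q J)) (ℕₚ.m<m+n (p ℕ.* q) (ℕₚ.*-mono-≤ 1≤p 1≤J))

admissible-shift : ∀ p q J i → admissible p q (q ℕ.+ J) (p ℕ.+ i) ≡ admissible p q J i
admissible-shift p q J i = does-⇔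
  (mk⇔ (λ le → ℕₚ.+-cancelˡ-≤ (p ℕ.* q) _ _ (subst₂ _≤_ lhs rhs le))
       (λ le → subst₂ _≤_ (sym lhs) (sym rhs) (ℕₚ.+-monoʳ-≤ (p ℕ.* q) le)))
  (_ ℕₚ.≤? _) (_ ℕₚ.≤? _)
  where
  lhs : p ℕ.* (q ℕ.+ J) ≡ p ℕ.* q ℕ.+ p ℕ.* J
  lhs = ℕₚ.*-distribˡ-+ p q J
  rhs : q ℕ.* ((p ℕ.+ i) ℕ.+ 1) ≡ p ℕ.* q ℕ.+ q ℕ.* (i ℕ.+ 1)
  rhs = begin
    q ℕ.* ((p ℕ.+ i) ℕ.+ 1)        ≡⟨ cong (q ℕ.*_) (ℕₚ.+-assoc p i 1) ⟩
    q ℕ.* (p ℕ.+ (i ℕ.+ 1))        ≡⟨ ℕₚ.*-distribˡ-+ q p (i ℕ.+ 1) ⟩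
    q ℕ.* p ℕ.+ q ℕ.* (i ℕ.+ 1)    ≡⟨ cong (ℕ._+ q ℕ.* (i ℕ.+ 1)) (ℕₚ.*-comm q p) ⟩
    p ℕ.* q ℕ.+ q ℕ.* (i ℕ.+ 1)    ∎

topSets-admissible-one : ∀ p q {j x} → 1 ≤ p → j ≤ q → p ≤ x → topSets (admissible p q j) 1 x ≡ 1
topSets-admissible-one p q {x = zero}  1≤p _   p≤0   = contradiction (ℕₚ.≤-trans 1≤p p≤0) λ ()
topSets-admissible-one p q {x = suc y} _   j≤q p≤1+y = topSets-one {Q = admissible p q _} (admissible-small p q j≤q p≤1+y)

∇^-topSets-vanish : ∀ p q {k} n → 1 ≤ p → k < q → p ℕ.+ q ≤ n →
                    ∇^ q (λ m → + topSets (admissible p q (suc k)) (suc k) m) n ≡ 0ℤ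
∇^-topSets-vanish p q {k} n 1≤p k<q p+q≤n = begin
  ∇^ q f n                  ≡⟨ cong (λ t → ∇^ t f n) (sym k+[1+d]≡q) ⟩
  ∇^ (k ℕ.+ suc d) f n      ≡⟨ ∇^-+ k (suc d) f n ⟩
  ∇^ (suc d) (∇^ k f) n     ≡⟨ ∇^-local (suc d) {∇^ k f} {λ _ → + 1} n ∇^k-f≡1 ⟩
  ∇^ (suc d) (λ _ → + 1) n  ≡⟨ ∇^-const d (+ 1) n ⟩
  0ℤ                        ∎
  where
  Q = admissible p q (suc k)
  f = λ m → + topSets Q (suc k) m
  d = q ∸ suc k
  k+[1+d]≡q : k ℕ.+ suc d ≡ q
  k+[1+d]≡q = trans (ℕₚ.+-suc k d) (ℕₚ.m+[n∸m]≡n k<q)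
  ∇^k-f≡1 : ∀ {i} → i ≤ suc d → ∇^ k f (n ∸ i) ≡ + 1
  ∇^k-f≡1 {i} i≤1+d = begin
    ∇^ k f (n ∸ i)                              ≡⟨ ∇^-cong k (n ∸ i) (λ m → cong (λ j → + topSets Q j m) (ℕₚ.+-comm 1 k)) ⟩
    ∇^ k (λ m → + topSets Q (k ℕ.+ 1) m) (n ∸ i) ≡⟨ ∇^-topSets (admissible-upward p q (suc k)) k 1 (s≤s z≤n) (n ∸ i) ⟩
    + topSets Q 1 (n ∸ i ∸ k)                   ≡⟨ cong +_ (topSets-admissible-one p q 1≤p k<q p≤n∸i∸k) ⟩
    + 1                                         ∎
    where
    i+k≤q : i ℕ.+ k ≤ q
    i+k≤q = ℕₚ.≤-trans (ℕₚ.+-monoˡ-≤ k i≤1+d) (ℕₚ.≤-reflexive (trans (ℕₚ.+-comm (suc d) k) k+[1+d]≡q))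
    p≤n∸i∸k : p ≤ n ∸ i ∸ k
    p≤n∸i∸k = subst (p ≤_) (sym (ℕₚ.∸-+-assoc n i k))
                (ℕₚ.m+n≤o⇒m≤o∸n p (ℕₚ.≤-trans (ℕₚ.+-monoʳ-≤ p i+k≤q) p+q≤n))

∇^-topSets-shift : ∀ p q {J} n → 1 ≤ p → 1 ≤ J → p ℕ.+ q ≤ n →
                   ∇^ q (λ m → + topSets (admissible p q (q ℕ.+ J)) (q ℕ.+ J) m) n ≡
                   + topSets (admissible p q J) J (n ∸ (p ℕ.+ q))
∇^-topSets-shift p q {J} n 1≤p 1≤J p+q≤n = begin
  ∇^ q (λ m → + topSets Q (q ℕ.+ J) m) n  ≡⟨ ∇^-topSets (admissible-upward p q (q ℕ.+ J)) q J 1≤J n ⟩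
  + topSets Q J (n ∸ q)                   ≡⟨ cong (λ x → + topSets Q J x) n∸q≡p+[n∸[p+q]] ⟩
  + topSets Q J (p ℕ.+ (n ∸ (p ℕ.+ q)))   ≡⟨ cong +_ (topSets-shift (admissible-below p q 1≤p 1≤J) (admissible-shift p q J) J _) ⟩
  + topSets (admissible p q J) J (n ∸ (p ℕ.+ q)) ∎
  where
  Q = admissible p q (q ℕ.+ J)
  n∸q≡p+[n∸[p+q]] : n ∸ q ≡ p ℕ.+ (n ∸ (p ℕ.+ q))
  n∸q≡p+[n∸[p+q]] = sym (trans (cong (λ x → p ℕ.+ (n ∸ x)) (ℕₚ.+-comm p q))
                        (trans (cong (p ℕ.+_) (sym (ℕₚ.∸-+-assoc n q p)))
                               (ℕₚ.m+[n∸m]≡n (ℕₚ.m+n≤o⇒m≤o∸n p p+q≤n))))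

∇^-cardS : ∀ p q n → 1 ≤ p → p ℕ.+ q ≤ n → ∇^ q (λ m → + cardS p q m) n ≡ + cardS p q (n ∸ (p ℕ.+ q))
∇^-cardS p q n 1≤p p+q≤n = begin
  ∇^ q (λ m → + cardS p q m) n
    ≡⟨ ∇^-local q n (λ {i} _ → cardS≡∑topSets p q (ℕₚ.m∸n≤m n i)) ⟩
  ∇^ q (λ m → ∑[1… n ] (λ j → g j m)) n
    ≡⟨ ∇^-∑ q n g n ⟩
  ∑[1… n ] G
    ≡⟨ cong (λ l → ∑[1… l ] G) (sym (ℕₚ.m+[n∸m]≡n (ℕₚ.m+n≤o⇒n≤o p p+q≤n))) ⟩
  ∑[1… q ℕ.+ (n ∸ q) ] G
    ≡⟨ ∑-split q (n ∸ q) G ⟩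
  ∑[1… q ] G + ∑[1… n ∸ q ] (λ J → G (q ℕ.+ J))
    ≡⟨ cong₂ _+_ (∑-zero q (λ k<q → ∇^-topSets-vanish p q n 1≤p k<q p+q≤n))
                 (∑-cong (n ∸ q) (λ _ → ∇^-topSets-shift p q n 1≤p (s≤s z≤n) p+q≤n)) ⟩
  0ℤ + ∑[1… n ∸ q ] (λ J → g J (n ∸ (p ℕ.+ q)))
    ≡⟨ ℤₚ.+-identityˡ _ ⟩
  ∑[1… n ∸ q ] (λ J → g J (n ∸ (p ℕ.+ q)))
    ≡⟨ sym (cardS≡∑topSets p q (ℕₚ.∸-monoʳ-≤ n (ℕₚ.m≤n+m q p))) ⟩
  + cardS p q (n ∸ (p ℕ.+ q)) ∎
  where
  g : ℕ → ℕ → ℤ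
  g j m = + topSets (admissible p q j) j m
  G : ℕ → ℤ
  G j = ∇^ q (g j) n

theorem1p1 : (p q : ℕ) → p ≥ 1 → q ≥ 1 → (n : ℕ) → n ≥ p Data.Nat.+ q →
    + cardS p q n ≡
      ∑[1… q ] (λ k → (-1ℤ Data.Integer.^ (k Data.Nat.+ 1)) * + (q C k) * + cardS p q (n ∸ k))
      + + cardS p q (n ∸ (p Data.Nat.+ q))
theorem1p1 p q p≥1 _ n n≥p+q = begin
  a n                    ≡⟨ solve 2 (λ x b → x := b :+ (x :- b)) refl (a n) B ⟩
  B + (a n - B)          ≡⟨ cong (_+_ B) (sym (∇^-binomial q a n)) ⟩
  B + ∇^ q a n           ≡⟨ cong (_+_ B) (∇^-cardS p q n p≥1 n≥p+q) ⟩
  B + a (n ∸ (p ℕ.+ q))  ∎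
  where
  a : ℕ → ℤ
  a m = + cardS p q m
  B : ℤ
  B = binomialTail q a n
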